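{- Let $R$ be a ring. Suppose given $R$-modules and $R$-linear maps $\alpha_1:A_1\to A_2$, $\alpha_2:A_2\to A_3$, $\beta_1:B_1\to B_2$, $\beta_2:B_2\to B_3$, $\iota_j:A_j\to B_j$ ($j=1,2,3$), $\pi_2:B_2\to T_2$, $\pi_3:B_3\to T_3$, $\tau_2:T_2\to T_3$, such that: the rows $0\to A_1\xrightarrow{\alpha_1}A_2\xrightarrow{\alpha_2}A_3\to 0$ and $0\to B_1\xrightarrow{\beta_1}B_2\xrightarrow{\beta_2}B_3\to 0$ are exact; the columns $0\to A_2\xrightarrow{\iota_2}B_2\xrightarrow{\pi_2}T_2\to 0$ and $0\to A_3\xrightarrow{\iota_3}B_3\xrightarrow{\pi_3}T_3\to 0$ are exact; and the diagram commutes, i.e. $\beta_1\circ\iota_1=\iota_2\circ\alpha_1$, $\beta_2\circ\iota_2=\iota_3\circ\alpha_2$ and $\pi_3\circ\beta_2=\tau_2\circ\pi_2$. Suppose that $\tau_2$ (or equivalently $\iota_1$) is an isomorphism. Then the following are equivalent: (i) $\alpha_2$ and $\pi_2$ split (i.e. each admits an $R$-linear section); (ii) $\beta_2$ and $\pi_3$ split. -}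

module Defs where

open import Level using (Level; _⊔_; suc)
open import Data.Product using (Σ; ∃; _×_)
open import Algebra.Bundles using (Ring)
open import Algebra.Module.Bundles using (LeftModule)
open import Algebra.Module.Morphism.Structures using (module LeftModuleMorphisms)

module ModuleTheory {r ℓr : Level} (R : Ring r ℓr) (m ℓm : Level) where

  Mod : Set (r ⊔ ℓr ⊔ suc (m ⊔ ℓm))
  Mod = LeftModule R m ℓm

  open LeftModule using (Carrierᴹ; _≈ᴹ_; 0ᴹ; rawLeftModule)

  record Hom (M N : Mod) : Set (r ⊔ m ⊔ ℓm) where
    field
      ⟦_⟧   : Carrierᴹ M → Carrierᴹ N
      isHom : LeftModuleMorphisms.IsLeftModuleHomomorphism
                (rawLeftModule M) (rawLeftModule N) ⟦_⟧
  open Hom public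

  module _ {M N : Mod} where
    Injectiveₗ : Hom M N → Set (m ⊔ ℓm)
    Injectiveₗ f = ∀ x y → _≈ᴹ_ N (⟦ f ⟧ x) (⟦ f ⟧ y) → _≈ᴹ_ M x y

    Surjectiveₗ : Hom M N → Set (m ⊔ ℓm)
    Surjectiveₗ f = ∀ y → ∃ λ x → _≈ᴹ_ N (⟦ f ⟧ x) y

    IsIso : Hom M N → Set (m ⊔ ℓm)
    IsIso f = Injectiveₗ f × Surjectiveₗ f

    Splits : Hom M N → Set (r ⊔ m ⊔ ℓm)
    Splits g = Σ (Hom N M) λ s → ∀ y → _≈ᴹ_ N (⟦ g ⟧ (⟦ s ⟧ y)) y

  ExactAt : {L M N : Mod} → Hom L M → Hom M N → Set (m ⊔ ℓm)
  ExactAt {L} {M} {N} f g =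
    (∀ x → _≈ᴹ_ N (⟦ g ⟧ (⟦ f ⟧ x)) (0ᴹ N)) ×
    (∀ y → _≈ᴹ_ N (⟦ g ⟧ y) (0ᴹ N) → ∃ λ x → _≈ᴹ_ M (⟦ f ⟧ x) y)

  ShortExact : {L M N : Mod} → Hom L M → Hom M N → Set (m ⊔ ℓm)
  ShortExact f g = Injectiveₗ f × ExactAt f g × Surjectiveₗ g

  Commutes : {X Y W Z : Mod} → Hom X Y → Hom Y Z → Hom X W → Hom W Z → Set (m ⊔ ℓm)
  Commutes {X} {Z = Z} f g h k = ∀ x → _≈ᴹ_ Z (⟦ g ⟧ (⟦ f ⟧ x)) (⟦ k ⟧ (⟦ h ⟧ x))

{-# OPTIONS --safe #-}
module Submission where

-- Only the two exact columns, the two right-hand squares and τ₂ are needed.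
-- If s and t are sections of α₂ and π₂, then u = β₂ ∘ t ∘ τ₂⁻¹ is a section of
-- π₃; it decomposes every b ∈ B₃ as ι₃ (ρ b) + u (π₃ b), and
-- b ↦ ι₂ (s (ρ b)) + t (τ₂⁻¹ (π₃ b)) is a section of β₂.  Conversely, if σ and u
-- are sections of β₂ and π₃, then σ ∘ u ∘ τ₂ is a section of π₂ because τ₂ is
-- injective, and σ ∘ ι₃ lands in ker π₂ = im ι₂, so it lifts through ι₂ to a
-- section of α₂.

open import Defs
open import Level using (Level)
open import Data.Product using (_×_; _,_; proj₁; proj₂; Σ; ∃)
open import Function.Base using (id; _∘_)
open import Function.Bundles using (_⇔_; mk⇔)
open import Algebra.Bundles using (Ring; AbelianGroup)
open import Algebra.Module.Bundles using (LeftModule)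
open import Algebra.Module.Morphism.Structures using (module LeftModuleMorphisms)
import Algebra.Module.Morphism.Construct.Composition as Composition
import Algebra.Module.Morphism.Construct.Identity as Identity
import Algebra.Module.Properties.LeftModule as LeftModuleProperties
import Algebra.Properties.AbelianGroup as AbelianGroupProperties
import Algebra.Properties.CommutativeSemigroup as CommutativeSemigroupProperties
import Algebra.Properties.Group as GroupProperties
import Relation.Binary.Reasoning.Setoid as SetoidReasoning

module LinearMaps {r ℓr : Level} (R : Ring r ℓr) (m ℓm : Level) where
  open ModuleTheory R m ℓm

  module Linear {M N : Mod} (f : Hom M N) =
    LeftModuleMorphisms.IsLeftModuleHomomorphism (isHom f)

  module Elements (M : Mod) where
    open LeftModule M public
    open AbelianGroupProperties +ᴹ-abelianGroup public using (⁻¹-∙-comm)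
    open GroupProperties +ᴹ-group public using (ε⁻¹≈ε)
    open CommutativeSemigroupProperties (AbelianGroup.commutativeSemigroup +ᴹ-abelianGroup) public
      using (interchange)
    open LeftModuleProperties M public using (inverseʳ-uniqueᴹ)
    open SetoidReasoning ≈ᴹ-setoid public

  mkHom : ∀ {M N : Mod} →
    let module M = LeftModule M
        module N = LeftModule N
    in (f : M.Carrierᴹ → N.Carrierᴹ) →
    (∀ {x y} → x M.≈ᴹ y → f x N.≈ᴹ f y) →
    (∀ x y → f (x M.+ᴹ y) N.≈ᴹ f x N.+ᴹ f y) →
    f M.0ᴹ N.≈ᴹ N.0ᴹ →
    (∀ x → f (M.-ᴹ x) N.≈ᴹ N.-ᴹ f x) →
    (∀ c x → f (c M.*ₗ x) N.≈ᴹ c N.*ₗ f x) →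
    Hom M N
  mkHom f cong +-homo 0-homo neg-homo *-homo = record
    { ⟦_⟧ = f
    ; isHom = record
      { +ᴹ-isGroupHomomorphism = record
        { isMonoidHomomorphism = record
          { isMagmaHomomorphism = record
            { isRelHomomorphism = record { cong = cong }
            ; homo = +-homo }
          ; ε-homo = 0-homo }
        ; ⁻¹-homo = neg-homo }
      ; *ₗ-homo = *-homo } }

  idₗ : ∀ {M : Mod} → Hom M M
  idₗ {M} = record
    { ⟦_⟧   = id
    ; isHom = Identity.isLeftModuleHomomorphism (LeftModule.rawLeftModule M)
                (LeftModule.≈ᴹ-refl M) }

  infixr 9 _∘ₗ_
  _∘ₗ_ : ∀ {L M N : Mod} → Hom M N → Hom L M → Hom L N
  _∘ₗ_ {N = N} g f = record
    { ⟦_⟧   = ⟦ g ⟧ ∘ ⟦ f ⟧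
    ; isHom = Composition.isLeftModuleHomomorphism (LeftModule.≈ᴹ-trans N)
                (isHom f) (isHom g) }

  infixl 6 _+ₗ_
  _+ₗ_ : ∀ {M N : Mod} → Hom M N → Hom M N → Hom M N
  _+ₗ_ {N = N} f g = mkHom (λ x → ⟦ f ⟧ x +ᴹ ⟦ g ⟧ x)
    (λ e → +ᴹ-cong (Linear.⟦⟧-cong f e) (Linear.⟦⟧-cong g e))
    (λ x y → ≈ᴹ-trans (+ᴹ-cong (Linear.+ᴹ-homo f x y) (Linear.+ᴹ-homo g x y))
                       (interchange _ _ _ _))
    (≈ᴹ-trans (+ᴹ-cong (Linear.0ᴹ-homo f) (Linear.0ᴹ-homo g)) (+ᴹ-identityˡ _))
    (λ x → ≈ᴹ-trans (+ᴹ-cong (Linear.-ᴹ-homo f x) (Linear.-ᴹ-homo g x)) (⁻¹-∙-comm _ _))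
    (λ c x → ≈ᴹ-trans (+ᴹ-cong (Linear.*ₗ-homo f c x) (Linear.*ₗ-homo g c x))
                       (≈ᴹ-sym (*ₗ-distribˡ c _ _)))
    where open Elements N

  negₗ : ∀ {M : Mod} → Hom M M
  negₗ {M} = mkHom -ᴹ_ -ᴹ‿cong (λ x y → ≈ᴹ-sym (⁻¹-∙-comm x y)) ε⁻¹≈ε (λ _ → ≈ᴹ-refl)
    (λ c x → ≈ᴹ-sym (inverseʳ-uniqueᴹ (c *ₗ x) (c *ₗ -ᴹ x) (begin
      c *ₗ x +ᴹ c *ₗ -ᴹ x ≈⟨ *ₗ-distribˡ c x (-ᴹ x) ⟨
      c *ₗ (x +ᴹ -ᴹ x)    ≈⟨ *ₗ-congˡ (-ᴹ‿inverseʳ x) ⟩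
      c *ₗ 0ᴹ             ≈⟨ *ₗ-zeroʳ c ⟩
      0ᴹ                  ∎)))
    where open Elements M

  factor-through-injective : ∀ {L M X : Mod} (f : Hom L M) → Injectiveₗ f → (h : Hom X M) →
    let open LeftModule M using (_≈ᴹ_)
    in (∀ x → ∃ λ l → ⟦ f ⟧ l ≈ᴹ ⟦ h ⟧ x) →
       Σ (Hom X L) λ k → ∀ x → ⟦ f ⟧ (⟦ k ⟧ x) ≈ᴹ ⟦ h ⟧ x
  factor-through-injective {L} {M} {X} f f-inj h h⊆im-f =
    mkHom k k-cong k-+ᴹ-homo k-0ᴹ-homo k--ᴹ-homo k-*ₗ-homo , k-factors
    where
    open Elements M
    module L = LeftModule L
    module X = LeftModule X
    k : X.Carrierᴹ → L.Carrierᴹ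
    k x = proj₁ (h⊆im-f x)
    k-factors : ∀ x → ⟦ f ⟧ (k x) ≈ᴹ ⟦ h ⟧ x
    k-factors x = proj₂ (h⊆im-f x)
    k-cong : ∀ {x y} → x X.≈ᴹ y → k x L.≈ᴹ k y
    k-cong {x} {y} x≈y = f-inj _ _ (begin
      ⟦ f ⟧ (k x) ≈⟨ k-factors x ⟩
      ⟦ h ⟧ x     ≈⟨ Linear.⟦⟧-cong h x≈y ⟩
      ⟦ h ⟧ y     ≈⟨ k-factors y ⟨
      ⟦ f ⟧ (k y) ∎)
    k-+ᴹ-homo : ∀ x y → k (x X.+ᴹ y) L.≈ᴹ k x L.+ᴹ k y
    k-+ᴹ-homo x y = f-inj _ _ (begin
      ⟦ f ⟧ (k (x X.+ᴹ y))       ≈⟨ k-factors _ ⟩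
      ⟦ h ⟧ (x X.+ᴹ y)           ≈⟨ Linear.+ᴹ-homo h x y ⟩
      ⟦ h ⟧ x +ᴹ ⟦ h ⟧ y         ≈⟨ +ᴹ-cong (k-factors x) (k-factors y) ⟨
      ⟦ f ⟧ (k x) +ᴹ ⟦ f ⟧ (k y) ≈⟨ Linear.+ᴹ-homo f _ _ ⟨
      ⟦ f ⟧ (k x L.+ᴹ k y)       ∎)
    k-0ᴹ-homo : k X.0ᴹ L.≈ᴹ L.0ᴹ
    k-0ᴹ-homo = f-inj _ _ (begin
      ⟦ f ⟧ (k X.0ᴹ) ≈⟨ k-factors _ ⟩
      ⟦ h ⟧ X.0ᴹ     ≈⟨ Linear.0ᴹ-homo h ⟩
      0ᴹ             ≈⟨ Linear.0ᴹ-homo f ⟨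
      ⟦ f ⟧ L.0ᴹ     ∎)
    k--ᴹ-homo : ∀ x → k (X.-ᴹ x) L.≈ᴹ L.-ᴹ k x
    k--ᴹ-homo x = f-inj _ _ (begin
      ⟦ f ⟧ (k (X.-ᴹ x)) ≈⟨ k-factors _ ⟩
      ⟦ h ⟧ (X.-ᴹ x)     ≈⟨ Linear.-ᴹ-homo h x ⟩
      -ᴹ ⟦ h ⟧ x         ≈⟨ -ᴹ‿cong (k-factors x) ⟨
      -ᴹ ⟦ f ⟧ (k x)     ≈⟨ Linear.-ᴹ-homo f _ ⟨
      ⟦ f ⟧ (L.-ᴹ k x)   ∎)
    k-*ₗ-homo : ∀ c x → k (c X.*ₗ x) L.≈ᴹ c L.*ₗ k x
    k-*ₗ-homo c x = f-inj _ _ (begin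
      ⟦ f ⟧ (k (c X.*ₗ x)) ≈⟨ k-factors _ ⟩
      ⟦ h ⟧ (c X.*ₗ x)     ≈⟨ Linear.*ₗ-homo h c x ⟩
      c *ₗ ⟦ h ⟧ x         ≈⟨ *ₗ-congˡ (k-factors x) ⟨
      c *ₗ ⟦ f ⟧ (k x)     ≈⟨ Linear.*ₗ-homo f c _ ⟨
      ⟦ f ⟧ (c L.*ₗ k x)   ∎)

  iso⇒splits : ∀ {M N : Mod} {f : Hom M N} → IsIso f → Splits f
  iso⇒splits {f = f} (f-inj , f-surj) = factor-through-injective f f-inj idₗ f-surj

  splits-resp : ∀ {M N : Mod} {f g : Hom M N} →
    (∀ x → LeftModule._≈ᴹ_ N (⟦ f ⟧ x) (⟦ g ⟧ x)) → Splits f → Splits g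
  splits-resp {N = N} f≈g (s , s-sec) = s , λ y → ≈ᴹ-trans (≈ᴹ-sym (f≈g _)) (s-sec y)
    where open LeftModule N

  ∘-splits : ∀ {L M N : Mod} {g : Hom M N} {f : Hom L M} →
    Splits g → Splits f → Splits (g ∘ₗ f)
  ∘-splits {N = N} {g} (s , s-sec) (t , t-sec) =
    t ∘ₗ s , λ y → ≈ᴹ-trans (Linear.⟦⟧-cong g (t-sec _)) (s-sec y)
    where open LeftModule N

  splits-∘⇒splitsˡ : ∀ {L M N : Mod} {g : Hom M N} (f : Hom L M) →
    Splits (g ∘ₗ f) → Splits g
  splits-∘⇒splitsˡ f (s , s-sec) = f ∘ₗ s , s-sec

  splits-∘⇒splitsʳ : ∀ {L M N : Mod} {g : Hom M N} {f : Hom L M} →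
    Injectiveₗ g → Splits (g ∘ₗ f) → Splits f
  splits-∘⇒splitsʳ {g = g} g-inj (s , s-sec) = s ∘ₗ g , λ y → g-inj _ _ (s-sec (⟦ g ⟧ y))

  complementₗ : ∀ {B T : Mod} → Hom T B → Hom B T → Hom B B
  complementₗ u π = idₗ +ₗ negₗ ∘ₗ u ∘ₗ π

  complement∈ker : ∀ {B T : Mod} (π : Hom B T) (u : Hom T B) →
    let open LeftModule T using (_≈ᴹ_; 0ᴹ)
    in (∀ y → ⟦ π ⟧ (⟦ u ⟧ y) ≈ᴹ y) → ∀ b → ⟦ π ⟧ (⟦ complementₗ u π ⟧ b) ≈ᴹ 0ᴹ
  complement∈ker {B} {T} π u u-sec b = begin
    ⟦ π ⟧ (b B.+ᴹ B.-ᴹ ⟦ u ⟧ (⟦ π ⟧ b))         ≈⟨ Linear.+ᴹ-homo π _ _ ⟩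
    ⟦ π ⟧ b +ᴹ ⟦ π ⟧ (B.-ᴹ ⟦ u ⟧ (⟦ π ⟧ b))     ≈⟨ +ᴹ-congˡ (Linear.-ᴹ-homo π _) ⟩
    ⟦ π ⟧ b +ᴹ -ᴹ ⟦ π ⟧ (⟦ u ⟧ (⟦ π ⟧ b))       ≈⟨ +ᴹ-congˡ (-ᴹ‿cong (u-sec _)) ⟩
    ⟦ π ⟧ b +ᴹ -ᴹ ⟦ π ⟧ b                       ≈⟨ -ᴹ‿inverseʳ _ ⟩
    0ᴹ                                           ∎
    where
    open Elements T
    module B = LeftModule B

  section-decomposes : ∀ {A B T : Mod} (ι : Hom A B) (π : Hom B T) →
    Injectiveₗ ι → ExactAt ι π → (u : Hom T B) →
    (∀ y → LeftModule._≈ᴹ_ T (⟦ π ⟧ (⟦ u ⟧ y)) y) →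
    let open LeftModule B using (_≈ᴹ_; _+ᴹ_)
    in Σ (Hom B A) λ ρ → ∀ b → ⟦ ι ⟧ (⟦ ρ ⟧ b) +ᴹ ⟦ u ⟧ (⟦ π ⟧ b) ≈ᴹ b
  section-decomposes {A} {B} {T} ι π ι-inj (_ , ker⊆im) u u-sec =
    ρ , λ b → begin
      ⟦ ι ⟧ (⟦ ρ ⟧ b) +ᴹ ⟦ u ⟧ (⟦ π ⟧ b)              ≈⟨ +ᴹ-congʳ (ρ-factors b) ⟩
      (b +ᴹ -ᴹ ⟦ u ⟧ (⟦ π ⟧ b)) +ᴹ ⟦ u ⟧ (⟦ π ⟧ b)    ≈⟨ +ᴹ-assoc _ _ _ ⟩
      b +ᴹ (-ᴹ ⟦ u ⟧ (⟦ π ⟧ b) +ᴹ ⟦ u ⟧ (⟦ π ⟧ b))    ≈⟨ +ᴹ-congˡ (-ᴹ‿inverseˡ _) ⟩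
      b +ᴹ 0ᴹ                                          ≈⟨ +ᴹ-identityʳ b ⟩
      b                                                ∎
    where
    open Elements B
    lifted : Σ (Hom B A) λ ρ → ∀ b → ⟦ ι ⟧ (⟦ ρ ⟧ b) ≈ᴹ ⟦ complementₗ u π ⟧ b
    lifted = factor-through-injective ι ι-inj (complementₗ u π)
               (λ b → ker⊆im _ (complement∈ker π u u-sec b))
    ρ : Hom B A
    ρ = proj₁ lifted
    ρ-factors : ∀ b → ⟦ ι ⟧ (⟦ ρ ⟧ b) ≈ᴹ ⟦ complementₗ u π ⟧ b
    ρ-factors = proj₂ lifted

  section-preserves-kernel : ∀ {B₂ B₃ T₂ T₃ : Mod}
    (β : Hom B₂ B₃) (π₂ : Hom B₂ T₂) (π₃ : Hom B₃ T₃) (τ : Hom T₂ T₃) →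
    Commutes β π₃ π₂ τ → Injectiveₗ τ →
    (σ : Hom B₃ B₂) → (∀ y → LeftModule._≈ᴹ_ B₃ (⟦ β ⟧ (⟦ σ ⟧ y)) y) →
    ∀ y → LeftModule._≈ᴹ_ T₃ (⟦ π₃ ⟧ y) (LeftModule.0ᴹ T₃) →
    LeftModule._≈ᴹ_ T₂ (⟦ π₂ ⟧ (⟦ σ ⟧ y)) (LeftModule.0ᴹ T₂)
  section-preserves-kernel {T₂ = T₂} {T₃} β π₂ π₃ τ square τ-inj σ σ-sec y π₃y≈0 =
    τ-inj _ _ (begin
      ⟦ τ ⟧ (⟦ π₂ ⟧ (⟦ σ ⟧ y))  ≈⟨ square _ ⟨
      ⟦ π₃ ⟧ (⟦ β ⟧ (⟦ σ ⟧ y))  ≈⟨ Linear.⟦⟧-cong π₃ (σ-sec y) ⟩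
      ⟦ π₃ ⟧ y                  ≈⟨ π₃y≈0 ⟩
      0ᴹ                        ≈⟨ Linear.0ᴹ-homo τ ⟨
      ⟦ τ ⟧ (LeftModule.0ᴹ T₂)  ∎)
    where open Elements T₃

  lift-splitting : ∀ {A₂ A₃ B₂ B₃ T₃ : Mod} (α : Hom A₂ A₃) (β : Hom B₂ B₃)
    (ι₂ : Hom A₂ B₂) (ι₃ : Hom A₃ B₃) (π : Hom B₃ T₃) →
    Commutes ι₂ β α ι₃ → Injectiveₗ ι₃ → ExactAt ι₃ π →
    Splits α → Splits (π ∘ₗ β) → Splits β
  lift-splitting {A₃ = A₃} {B₂} {B₃} α β ι₂ ι₃ π
    square ι₃-inj exact (s , s-sec) (w , w-sec) =
    σ , λ b → begin
      ⟦ β ⟧ (⟦ ι₂ ⟧ (⟦ s ⟧ (⟦ ρ ⟧ b)) B₂.+ᴹ ⟦ w ⟧ (⟦ π ⟧ b))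
        ≈⟨ Linear.+ᴹ-homo β _ _ ⟩
      ⟦ β ⟧ (⟦ ι₂ ⟧ (⟦ s ⟧ (⟦ ρ ⟧ b))) +ᴹ ⟦ β ⟧ (⟦ w ⟧ (⟦ π ⟧ b))
        ≈⟨ +ᴹ-congʳ (square _) ⟩
      ⟦ ι₃ ⟧ (⟦ α ⟧ (⟦ s ⟧ (⟦ ρ ⟧ b))) +ᴹ ⟦ β ⟧ (⟦ w ⟧ (⟦ π ⟧ b))
        ≈⟨ +ᴹ-congʳ (Linear.⟦⟧-cong ι₃ (s-sec _)) ⟩
      ⟦ ι₃ ⟧ (⟦ ρ ⟧ b) +ᴹ ⟦ β ⟧ (⟦ w ⟧ (⟦ π ⟧ b))
        ≈⟨ ρ-decomposes b ⟩
      b ∎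
    where
    open Elements B₃
    module B₂ = LeftModule B₂
    decomposition : Σ (Hom B₃ A₃) λ ρ → ∀ b → ⟦ ι₃ ⟧ (⟦ ρ ⟧ b) +ᴹ ⟦ β ⟧ (⟦ w ⟧ (⟦ π ⟧ b)) ≈ᴹ b
    decomposition = section-decomposes ι₃ π ι₃-inj exact (β ∘ₗ w) w-sec
    ρ : Hom B₃ A₃
    ρ = proj₁ decomposition
    ρ-decomposes : ∀ b → ⟦ ι₃ ⟧ (⟦ ρ ⟧ b) +ᴹ ⟦ β ⟧ (⟦ w ⟧ (⟦ π ⟧ b)) ≈ᴹ b
    ρ-decomposes = proj₂ decomposition
    σ : Hom B₃ B₂
    σ = ι₂ ∘ₗ s ∘ₗ ρ +ₗ w ∘ₗ π

  descend-splitting : ∀ {A₂ A₃ B₂ B₃ T₂ : Mod} (α : Hom A₂ A₃) (β : Hom B₂ B₃)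
    (ι₂ : Hom A₂ B₂) (ι₃ : Hom A₃ B₃) (π : Hom B₂ T₂) →
    Commutes ι₂ β α ι₃ → Injectiveₗ ι₂ → ExactAt ι₂ π → Injectiveₗ ι₃ →
    (σ : Hom B₃ B₂) → (∀ y → LeftModule._≈ᴹ_ B₃ (⟦ β ⟧ (⟦ σ ⟧ y)) y) →
    (∀ a → LeftModule._≈ᴹ_ T₂ (⟦ π ⟧ (⟦ σ ⟧ (⟦ ι₃ ⟧ a))) (LeftModule.0ᴹ T₂)) →
    Splits α
  descend-splitting {A₂} {A₃} {B₂} {B₃} α β ι₂ ι₃ _
    square ι₂-inj (_ , ker⊆im) ι₃-inj σ σ-sec σι₃∈ker =
    s , λ a → ι₃-inj _ _ (begin
      ⟦ ι₃ ⟧ (⟦ α ⟧ (⟦ s ⟧ a))  ≈⟨ square _ ⟨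
      ⟦ β ⟧ (⟦ ι₂ ⟧ (⟦ s ⟧ a))  ≈⟨ Linear.⟦⟧-cong β (s-lifts a) ⟩
      ⟦ β ⟧ (⟦ σ ⟧ (⟦ ι₃ ⟧ a))  ≈⟨ σ-sec _ ⟩
      ⟦ ι₃ ⟧ a                  ∎)
    where
    open Elements B₃
    lifted : Σ (Hom A₃ A₂) λ s → ∀ a → LeftModule._≈ᴹ_ B₂ (⟦ ι₂ ⟧ (⟦ s ⟧ a)) (⟦ σ ⟧ (⟦ ι₃ ⟧ a))
    lifted = factor-through-injective ι₂ ι₂-inj (σ ∘ₗ ι₃) (λ a → ker⊆im _ (σι₃∈ker a))
    s : Hom A₃ A₂
    s = proj₁ lifted
    s-lifts : ∀ a → LeftModule._≈ᴹ_ B₂ (⟦ ι₂ ⟧ (⟦ s ⟧ a)) (⟦ σ ⟧ (⟦ ι₃ ⟧ a))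
    s-lifts = proj₂ lifted

lemma3p1 : ∀ {r ℓr m ℓm : Level} (R : Ring r ℓr) → let open ModuleTheory R m ℓm in
    {A₁ A₂ A₃ B₁ B₂ B₃ T₂ T₃ : Mod}
    (α₁ : Hom A₁ A₂) (α₂ : Hom A₂ A₃) (β₁ : Hom B₁ B₂) (β₂ : Hom B₂ B₃)
    (ι₁ : Hom A₁ B₁) (ι₂ : Hom A₂ B₂) (ι₃ : Hom A₃ B₃)
    (π₂ : Hom B₂ T₂) (π₃ : Hom B₃ T₃) (τ₂ : Hom T₂ T₃) →
    ShortExact α₁ α₂ → ShortExact β₁ β₂ →
    ShortExact ι₂ π₂ → ShortExact ι₃ π₃ →
    Commutes ι₁ β₁ α₁ ι₂ → Commutes ι₂ β₂ α₂ ι₃ → Commutes β₂ π₃ π₂ τ₂ →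
    IsIso τ₂ →
    (Splits α₂ × Splits π₂) ⇔ (Splits β₂ × Splits π₃)
lemma3p1 {m = m} {ℓm = ℓm} R {T₂ = T₂} {T₃} _ α₂ _ β₂ _ ι₂ ι₃ π₂ π₃ τ₂ _ _
  (ι₂-inj , ι₂π₂-exact , _) (ι₃-inj , ι₃π₃-exact@(π₃ι₃≈0 , _) , _)
  _ square₂ square₃ τ₂-iso@(τ₂-inj , _) =
  mk⇔ forward backward
  where
  open ModuleTheory R m ℓm
  open LinearMaps R m ℓm
  open LeftModule T₃ using (≈ᴹ-sym)

  forward : Splits α₂ × Splits π₂ → Splits β₂ × Splits π₃
  forward (α₂-splits , π₂-splits) =
    lift-splitting α₂ β₂ ι₂ ι₃ π₃ square₂ ι₃-inj ι₃π₃-exact α₂-splits π₃∘β₂-splits ,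
    splits-∘⇒splitsˡ {g = π₃} β₂ π₃∘β₂-splits
    where
    τ₂∘π₂-splits : Splits (τ₂ ∘ₗ π₂)
    τ₂∘π₂-splits = ∘-splits {g = τ₂} {π₂} (iso⇒splits {f = τ₂} τ₂-iso) π₂-splits
    π₃∘β₂-splits : Splits (π₃ ∘ₗ β₂)
    π₃∘β₂-splits =
      splits-resp {f = τ₂ ∘ₗ π₂} {π₃ ∘ₗ β₂} (λ b → ≈ᴹ-sym (square₃ b)) τ₂∘π₂-splits

  backward : Splits β₂ × Splits π₃ → Splits α₂ × Splits π₂
  backward ((σ , σ-sec) , π₃-splits) =
    descend-splitting α₂ β₂ ι₂ ι₃ π₂ square₂ ι₂-inj ι₂π₂-exact ι₃-inj σ σ-sec σι₃∈ker ,
    splits-∘⇒splitsʳ {g = τ₂} {f = π₂} τ₂-inj τ₂∘π₂-splits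
    where
    σι₃∈ker : ∀ a → LeftModule._≈ᴹ_ T₂ (⟦ π₂ ⟧ (⟦ σ ⟧ (⟦ ι₃ ⟧ a))) (LeftModule.0ᴹ T₂)
    σι₃∈ker a = section-preserves-kernel β₂ π₂ π₃ τ₂ square₃ τ₂-inj σ σ-sec _ (π₃ι₃≈0 a)
    π₃∘β₂-splits : Splits (π₃ ∘ₗ β₂)
    π₃∘β₂-splits = ∘-splits {g = π₃} {β₂} π₃-splits (σ , σ-sec)
    τ₂∘π₂-splits : Splits (τ₂ ∘ₗ π₂)
    τ₂∘π₂-splits = splits-resp {f = π₃ ∘ₗ β₂} {τ₂ ∘ₗ π₂} square₃ π₃∘β₂-splits
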